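{- Let $k\ge 3$ and let $G$ be an even $k$-melon graph with paths $P^{(1)},\dots,P^{(k)}$. For $i\in\{1,\dots,k\}$ let $U_i$ be the vertex set such that $P^{(i)}$ is external with respect to $U_i$ and every $P^{(j)}$, $j\ne i$, is internal with respect to $U_i$. Then $\mathrm{evc}(G)=\mathrm{vc}(G)+1$, and $\mathcal{U}=\{U_i : i\in\{1,\dots,k\}\}$ is a minimum eternal vertex cover class of $G$.
   Context: For $k\ge1$, a $k$-melon graph is the union of $k$ pairwise internally vertex-disjoint paths $P^{(1)},\dots,P^{(k)}$, each of length at least $1$, with the same two distinct endpoints $s$ and $t$; it is even if every path has even length. For a path $P$ of length $2m$ with vertices $v_0,\dots,v_{2m}$, $\{v_0,v_{2m}\}=\{s,t\}$, and a vertex set $U$: $P$ is internal w.r.t. $U$ if $U\cap V(P)=\{v_{2j}:0\le j\le m\}$, and external w.r.t. $U$ if $U\cap V(P)=\{v_{2j+1}:0\le j\le m-1\}\cup\{s,t\}$. $\mathrm{vc}(G)$ is the vertex cover number. For a vertex cover $U$ of $G=(V,E)$ and an edge $e=vw$, a defense of $U$ against $e$ is a one-to-one map $\phi:U\to V$ with $\phi(u)\in N[u]$ for all $u\in U$ and $\phi(v)=w$ (with $v\in U$) or $\phi(w)=v$ (with $w\in U$). An eternal vertex cover class is a family $\mathcal{U}$ of vertex covers of equal cardinality (its size) such that for every $U\in\mathcal{U}$ and every edge $e$ there is a defense $\phi$ of $U$ against $e$ with $\phi(U)\in\mathcal{U}$; $\mathrm{evc}(G)$ is the minimum size of such a class,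 and a class of that size is minimum. -}

module Defs where

open import Level using (0ℓ)
open import Data.Nat using (ℕ; zero; suc; _+_; _*_; _≤_)
open import Data.Fin using (Fin; toℕ; fromℕ; inject₁) renaming (zero to fzero; suc to fsuc)
open import Data.Fin.Subset using (Subset; _∈_; ∣_∣)
open import Data.Product using (Σ; ∃; _×_; _,_)
open import Data.Sum using (_⊎_)
open import Relation.Binary.PropositionalEquality using (_≡_; _≢_)
open import Function.Definitions using (Injective)

-- For the melon graphs below, E is forced to be
-- exactly the (symmetric, loopless) edge relation of the union of the paths.

Rel : ℕ → Set₁
Rel n = Fin n → Fin n → Set

_⇔_ : Set → Set → Set
A ⇔ B = (A → B) × (B → A)

-- An even k-melon graph structure on (Fin n, E):
-- k internally vertex-disjoint paths P⁽ⁱ⁾ of even length 2·m i ≥ 2 from s to t,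
-- path i having vertices v i 0 = s, …, v i (2·m i) = t; the vertex set of G is
-- the union of the paths and the edges are exactly the path edges.
record EvenMelon (n k : ℕ) (E : Rel n) : Set where
  field
    s t      : Fin n
    s≢t      : s ≢ t
    m        : Fin k → ℕ
    m≥1      : ∀ i → 1 ≤ m i
    v        : (i : Fin k) → Fin (suc (2 * m i)) → Fin n
    v-start  : ∀ i → v i fzero ≡ s
    v-end    : ∀ i → v i (fromℕ (2 * m i)) ≡ t
    v-path   : ∀ i → Injective _≡_ _≡_ (v i)
    v-disj   : ∀ i j (p : Fin (suc (2 * m i))) (q : Fin (suc (2 * m j))) →
               i ≢ j → v i p ≡ v j q → (v i p ≡ s) ⊎ (v i p ≡ t)
    v-cover  : ∀ x → Σ (Fin k) λ i → Σ (Fin (suc (2 * m i))) λ p → v i p ≡ x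
    edges    : ∀ x y → E x y ⇔
               (Σ (Fin k) λ i → Σ (Fin (2 * m i)) λ p →
                  ((x ≡ v i (inject₁ p)) × (y ≡ v i (fsuc p)))
                ⊎ ((y ≡ v i (inject₁ p)) × (x ≡ v i (fsuc p))))

module _ {n k : ℕ} {E : Rel n} (M : EvenMelon n k E) where
  open EvenMelon M

  Internal : Fin k → Subset n → Set
  Internal j U = ∀ (p : Fin (suc (2 * m j))) →
    (v j p ∈ U) ⇔ (∃ λ q → toℕ p ≡ 2 * q)

  External : Fin k → Subset n → Set
  External j U = ∀ (p : Fin (suc (2 * m j))) →
    (v j p ∈ U) ⇔ ((∃ λ q → toℕ p ≡ 2 * q + 1) ⊎ (toℕ p ≡ 0) ⊎ (toℕ p ≡ 2 * m j))

  IsU : Fin k → Subset n → Set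
  IsU i U = External i U × (∀ j → j ≢ i → Internal j U)

  melonFamily : Subset n → Set
  melonFamily U = Σ (Fin k) λ i → IsU i U

module _ {n : ℕ} (E : Rel n) where

  IsVertexCover : Subset n → Set
  IsVertexCover U = ∀ x y → E x y → (x ∈ U) ⊎ (y ∈ U)

  IsVCNumber : ℕ → Set
  IsVCNumber c = (Σ (Subset n) λ U → IsVertexCover U × ∣ U ∣ ≡ c)
               × (∀ U → IsVertexCover U → c ≤ ∣ U ∣)

  _∈N[_] : Fin n → Fin n → Set
  y ∈N[ u ] = (y ≡ u) ⊎ E u y

  IsDefense : Subset n → Fin n → Fin n → (Fin n → Fin n) → Set
  IsDefense U a b φ =
      (∀ u → u ∈ U → φ u ∈N[ u ])
    × (∀ u u' → u ∈ U → u' ∈ U → φ u ≡ φ u' → u ≡ u')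
    × (((a ∈ U) × (φ a ≡ b)) ⊎ ((b ∈ U) × (φ b ≡ a)))

  IsImage : Subset n → (Fin n → Fin n) → Subset n → Set
  IsImage U φ W = ∀ x → (x ∈ W) ⇔ (∃ λ u → (u ∈ U) × (φ u ≡ x))

  IsEVCClass : (Subset n → Set) → ℕ → Set
  IsEVCClass 𝒰 c =
      (∃ λ U → 𝒰 U)
    × (∀ U → 𝒰 U → IsVertexCover U × ∣ U ∣ ≡ c)
    × (∀ U → 𝒰 U → ∀ a b → E a b →
         Σ (Fin n → Fin n) λ φ → IsDefense U a b φ ×
           Σ (Subset n) λ W → 𝒰 W × IsImage U φ W)

  IsEVCNumber : ℕ → Set₁
  IsEVCNumber c = (Σ (Subset n → Set) λ 𝒰 → IsEVCClass 𝒰 c)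
                × (∀ 𝒰 c' → IsEVCClass 𝒰 c' → c ≤ c')

  IsMinimumEVCClass : (Subset n → Set) → Set₁
  IsMinimumEVCClass 𝒰 = Σ ℕ λ c → IsEVCClass 𝒰 c × IsEVCNumber c

{-# OPTIONS --safe #-}
-- U₀, made of s, t and the even inner vertices, is a vertex cover, and a matching of the same size
-- proves it minimum.  With three paths the matching can avoid any given odd inner vertex, so no
-- cover of size vc(G) contains one; as an attack on the edge from s to an odd vertex forces such a
-- vertex into some cover of an eternal class, evc(G) > vc(G).  Conversely U i has one vertex more
-- than U₀, and it is defended against every edge by rotating the cover one step around the cycle
-- formed by path i and another path j, which yields U j: through s for the edges whose end nearer
-- to s is at an even position, through t (the same rotation in the reversed melon) for the others.
module Submission where

open import Defs
open import Data.Bool using (Bool; true; false; not; _xor_)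
open import Data.Bool.Properties
  using (not-involutive; not-injective; not-distribˡ-xor; not-distribʳ-xor; xor-same)
open import Data.Empty using (⊥-elim)
open import Data.Fin using (Fin; toℕ; fromℕ; fromℕ<; inject₁; opposite; _≟_)
  renaming (zero to fzero; suc to fsuc)
import Data.Fin.Properties as Fin
open import Data.Fin.Subset using (Subset; _∈_; _∉_; _⊂_; _∪_; _-_; ⁅_⁆; ∣_∣; inside; outside)
open import Data.Fin.Subset.Properties
  using (_∈?_; ⊆-antisym; p⊆p∪q; x∈p∪q⁺; x∈p∪q⁻; x∈⁅x⁆; x∈⁅y⁆⇒x≡y; ∣⁅x⁆∣≡1;
         p⊂q⇒∣p∣<∣q∣; x∈p∧x≢y⇒x∈p-y; x∈p⇒∣p-x∣<∣p∣)
open import Data.Nat using (ℕ; zero; suc; pred; _+_; _*_; _∸_; _≤_; _<_; z≤n; s≤s; _<?_; >-nonZero)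
import Data.Nat.Properties as ℕ
open import Data.Product using (Σ; ∃; _×_; _,_; proj₁; proj₂)
import Data.Product as Σ
open import Data.Sum using (_⊎_; inj₁; inj₂; [_,_])
import Data.Sum as Sum
open import Data.Vec using ([]; _∷_; tabulate; here; there)
open import Data.Vec.Properties using ([]=⇒lookup; lookup⇒[]=; lookup∘tabulate)
open import Function using (_∘_; id)
open import Relation.Binary.PropositionalEquality
  using (_≡_; _≢_; refl; sym; trans; cong; cong₂; subst; subst₂; module ≡-Reasoning)
open import Relation.Nullary using (¬_; yes; no; does)
open import Relation.Nullary.Decidable using (dec-true; dec-false)

∈-tabulate⁺ : ∀ {n} {f : Fin n → Bool} {x} → f x ≡ true → x ∈ tabulate f
∈-tabulate⁺ {f = f} {x} fx = lookup⇒[]= x (tabulate f) (trans (lookup∘tabulate f x) fx)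

∈-tabulate⁻ : ∀ {n} {f : Fin n → Bool} {x} → x ∈ tabulate f → f x ≡ true
∈-tabulate⁻ {f = f} {x} x∈ = trans (sym (lookup∘tabulate f x)) ([]=⇒lookup x∈)

injection⇒∣p∣≤∣q∣ : ∀ {n m} (p : Subset n) (q : Subset m) (f : Fin n → Fin m) →
  (∀ {x} → x ∈ p → f x ∈ q) → (∀ {x y} → x ∈ p → y ∈ p → f x ≡ f y → x ≡ y) →
  ∣ p ∣ ≤ ∣ q ∣
injection⇒∣p∣≤∣q∣ [] q f into inj = z≤n
injection⇒∣p∣≤∣q∣ (outside ∷ p) q f into inj =
  injection⇒∣p∣≤∣q∣ p q (f ∘ fsuc) (into ∘ there)
    (λ x∈p y∈p e → Fin.suc-injective (inj (there x∈p) (there y∈p) e))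
injection⇒∣p∣≤∣q∣ (inside ∷ p) q f into inj = begin
  suc ∣ p ∣            ≤⟨ s≤s (injection⇒∣p∣≤∣q∣ p (q - f fzero) (f ∘ fsuc) into′ inj′) ⟩
  suc ∣ q - f fzero ∣  ≤⟨ x∈p⇒∣p-x∣<∣p∣ (into here) ⟩
  ∣ q ∣                ∎
  where
  open ℕ.≤-Reasoning
  into′ : ∀ {x} → x ∈ p → f (fsuc x) ∈ q - f fzero
  into′ x∈p = x∈p∧x≢y⇒x∈p-y (into (there x∈p)) (λ e → Fin.0≢1+n (inj here (there x∈p) (sym e)))
  inj′ : ∀ {x y} → x ∈ p → y ∈ p → f (fsuc x) ≡ f (fsuc y) → x ≡ y
  inj′ x∈p y∈p e = Fin.suc-injective (inj (there x∈p) (there y∈p) e)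

∣p∪q∣≤∣p∣+∣q∣ : ∀ {n} (p q : Subset n) → ∣ p ∪ q ∣ ≤ ∣ p ∣ + ∣ q ∣
∣p∪q∣≤∣p∣+∣q∣ [] [] = z≤n
∣p∪q∣≤∣p∣+∣q∣ (outside ∷ p) (outside ∷ q) = ∣p∪q∣≤∣p∣+∣q∣ p q
∣p∪q∣≤∣p∣+∣q∣ (outside ∷ p) (inside ∷ q) =
  ℕ.≤-trans (s≤s (∣p∪q∣≤∣p∣+∣q∣ p q)) (ℕ.≤-reflexive (sym (ℕ.+-suc ∣ p ∣ ∣ q ∣)))
∣p∪q∣≤∣p∣+∣q∣ (inside ∷ p) (outside ∷ q) = s≤s (∣p∪q∣≤∣p∣+∣q∣ p q)
∣p∪q∣≤∣p∣+∣q∣ (inside ∷ p) (inside ∷ q) =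
  s≤s (ℕ.≤-trans (∣p∪q∣≤∣p∣+∣q∣ p q) (ℕ.+-monoʳ-≤ ∣ p ∣ (ℕ.n≤1+n ∣ q ∣)))

-- Each vertex of Z missing from U is traded for its partner, which U must contain; ρ makes the
-- trade injective.
partners⇒∣p∣≤∣cover∣ : ∀ {n} (E : Rel n) {U} (Z : Subset n) (π ρ : Fin n → Fin n) →
  IsVertexCover E U → (∀ {z} → z ∈ Z → z ∉ U → E z (π z) × π z ∉ Z × ρ (π z) ≡ z) → ∣ Z ∣ ≤ ∣ U ∣
partners⇒∣p∣≤∣cover∣ {n} E {U} Z π ρ cover partner =
  injection⇒∣p∣≤∣q∣ Z U f f-into λ x∈Z y∈Z e →
    trans (sym (g∘f x∈Z)) (trans (cong g e) (g∘f y∈Z))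
  where
  f : Fin n → Fin n
  f z with z ∈? U
  ... | yes _ = z
  ... | no  _ = π z

  g : Fin n → Fin n
  g y with y ∈? Z
  ... | yes _ = y
  ... | no  _ = ρ y

  f-into : ∀ {z} → z ∈ Z → f z ∈ U
  f-into {z} z∈Z with z ∈? U
  ... | yes z∈U = z∈U
  ... | no  z∉U with cover z (π z) (proj₁ (partner z∈Z z∉U))
  ...   | inj₁ z∈U  = ⊥-elim (z∉U z∈U)
  ...   | inj₂ πz∈U = πz∈U

  g∘f : ∀ {z} → z ∈ Z → g (f z) ≡ z
  g∘f {z} z∈Z with z ∈? U
  ... | yes _ with z ∈? Z
  ...   | yes _   = refl
  ...   | no  z∉Z = ⊥-elim (z∉Z z∈Z)
  g∘f {z} z∈Z | no z∉U with π z ∈? Z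
  ...   | yes πz∈Z = ⊥-elim (proj₁ (proj₂ (partner z∈Z z∉U)) πz∈Z)
  ...   | no  _    = proj₂ (proj₂ (partner z∈Z z∉U))

true≢false : true ≢ false
true≢false ()

even : ℕ → Bool
even zero    = true
even (suc a) = not (even a)

even-+ : ∀ a b → even (a + b) ≡ not (even a) xor even b
even-+ zero    b = refl
even-+ (suc a) b = trans (cong not (even-+ a b)) (not-distribˡ-xor (not (even a)) (even b))

even-pred : ∀ {a} → 0 < a → even (pred a) ≡ not (even a)
even-pred {suc a} _ = sym (not-involutive (even a))

even-2* : ∀ q → even (2 * q) ≡ true
even-2* q = begin
  even (q + (q + 0))          ≡⟨ even-+ q (q + 0) ⟩
  not (even q) xor even (q + 0) ≡⟨ cong (λ b → not (even q) xor even b) (ℕ.+-identityʳ q) ⟩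
  not (even q) xor even q     ≡⟨ sym (not-distribˡ-xor (even q) (even q)) ⟩
  not (even q xor even q)     ≡⟨ cong not (xor-same (even q)) ⟩
  true                        ∎
  where open ≡-Reasoning

even-2*+1 : ∀ q → even (2 * q + 1) ≡ false
even-2*+1 q = trans (even-+ (2 * q) 1) (cong (λ b → not b xor false) (even-2* q))

even⇒2* : ∀ {a} → even a ≡ true → ∃ λ q → a ≡ 2 * q
odd⇒2*+1 : ∀ {a} → even a ≡ false → ∃ λ q → a ≡ 2 * q + 1
even⇒2* {zero} _ = 0 , refl
even⇒2* {suc a} e with odd⇒2*+1 {a} (not-injective e)
... | q , refl = suc q , trans (cong suc (ℕ.+-comm (2 * q) 1)) (sym (ℕ.*-suc 2 q))
odd⇒2*+1 {suc a} e with even⇒2* {a} (not-injective e)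
... | q , refl = q , ℕ.+-comm 1 (2 * q)

even-∸ : ∀ {a b} → b ≤ a → even a ≡ true → even (a ∸ b) ≡ even b
even-∸ {a} {b} b≤a even-a = not-xor≡true⇒≡ (even (a ∸ b)) (even b) (begin
  not (even (a ∸ b)) xor even b  ≡⟨ sym (even-+ (a ∸ b) b) ⟩
  even (a ∸ b + b)               ≡⟨ cong even (ℕ.m∸n+n≡m b≤a) ⟩
  even a                         ≡⟨ even-a ⟩
  true                           ∎)
  where
  open ≡-Reasoning
  not-xor≡true⇒≡ : ∀ x y → not x xor y ≡ true → x ≡ y
  not-xor≡true⇒≡ false false _ = refl
  not-xor≡true⇒≡ true  true  _ = refl

opposite-fromℕ : ∀ n → opposite (fromℕ n) ≡ fzero
opposite-fromℕ zero    = refl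
opposite-fromℕ (suc n) = cong inject₁ (opposite-fromℕ n)

opposite-inject₁ : ∀ {n} (p : Fin n) → opposite (inject₁ p) ≡ fsuc (opposite p)
opposite-inject₁ {suc n} fzero    = refl
opposite-inject₁ {suc n} (fsuc p) = cong inject₁ (opposite-inject₁ p)

opposite-injective : ∀ {n} {p q : Fin n} → opposite p ≡ opposite q → p ≡ q
opposite-injective {p = p} {q} e =
  trans (sym (Fin.opposite-involutive p)) (trans (cong opposite e) (Fin.opposite-involutive q))

SamePair : ∀ {A : Set} → A → A → A → A → Set
SamePair x y a b = ((x ≡ a) × (y ≡ b)) ⊎ ((y ≡ a) × (x ≡ b))

SamePair-swap : ∀ {A : Set} {x y a b : A} → SamePair x y a b → SamePair x y b a
SamePair-swap = Sum.swap ∘ Sum.map Σ.swap Σ.swap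

reverse : ∀ {n k} {E : Rel n} → EvenMelon n k E → EvenMelon n k E
reverse {n} {k} M = record
  { s       = t
  ; t       = s
  ; s≢t     = s≢t ∘ sym
  ; m       = m
  ; m≥1     = m≥1
  ; v       = v′
  ; v-start = v-end
  ; v-end   = λ i → trans (cong (v i) (opposite-fromℕ (2 * m i))) (v-start i)
  ; v-path  = λ i e → opposite-injective (v-path i e)
  ; v-disj  = λ i j p q i≢j e → Sum.swap (v-disj i j (opposite p) (opposite q) i≢j e)
  ; v-cover = λ x → Σ.map₂ (λ {i} (p , e) → opposite p , trans (cong (v i) (Fin.opposite-involutive p)) e)
                           (v-cover x)
  ; edges   = λ x y → (λ e → reversed (proj₁ (edges x y) e)) , (λ e → proj₂ (edges x y) (unreversed e))
  }
  where
  open EvenMelon M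
  v′ : ∀ i → Fin (suc (2 * m i)) → Fin n
  v′ i = v i ∘ opposite
  EdgeAlong : (∀ i → Fin (suc (2 * m i)) → Fin n) → Fin n → Fin n → Set
  EdgeAlong w x y = Σ (Fin k) λ i → Σ (Fin (2 * m i)) λ p → SamePair x y (w i (inject₁ p)) (w i (fsuc p))
  reversed : ∀ {x y} → EdgeAlong v x y → EdgeAlong v′ x y
  reversed (i , p , same) = i , opposite p , subst₂ (SamePair _ _) up down (SamePair-swap same)
    where
    up : v i (fsuc p) ≡ v′ i (inject₁ (opposite p))
    up = cong (v i) (trans (cong fsuc (sym (Fin.opposite-involutive p))) (sym (opposite-inject₁ (opposite p))))
    down : v i (inject₁ p) ≡ v′ i (fsuc (opposite p))
    down = cong (v i ∘ inject₁) (sym (Fin.opposite-involutive p))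
  unreversed : ∀ {x y} → EdgeAlong v′ x y → EdgeAlong v x y
  unreversed (i , p , same) =
    i , opposite p , subst₂ (SamePair _ _) refl (cong (v i) (opposite-inject₁ p)) (SamePair-swap same)

module Positions {n k : ℕ} {E : Rel n} (M : EvenMelon n k E) where
  open EvenMelon M

  L : Fin k → ℕ
  L i = 2 * m i

  Inner : Fin k → ℕ → Set
  Inner i a = 0 < a × a < L i

  0<L : ∀ i → 0 < L i
  0<L i = ℕ.<-trans (s≤s z≤n) (ℕ.*-monoʳ-≤ 2 (m≥1 i))

  inner-1 : ∀ i → Inner i 1
  inner-1 i = s≤s z≤n , ℕ.*-monoʳ-≤ 2 (m≥1 i)

  even-L : ∀ i → even (L i) ≡ true
  even-L i = even-2* (m i)

  -- V and byPosition are used only through their characterising lemmas; unfolding them during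
  -- unification makes type checking very slow.
  opaque
    -- The vertex at distance a from s along path i; junk (s) when a > L i.
    V : Fin k → ℕ → Fin n
    V i a with a <? suc (L i)
    ... | yes a≤L = v i (fromℕ< a≤L)
    ... | no  _   = s

    V-fromℕ< : ∀ {i a} (a≤L : a < suc (L i)) → V i a ≡ v i (fromℕ< a≤L)
    V-fromℕ< {i} {a} a≤L with a <? suc (L i)
    ... | yes a≤L′ = cong (v i) (Fin.fromℕ<-cong a a refl a≤L′ a≤L)
    ... | no  a≰L  = ⊥-elim (a≰L a≤L)

  V-toℕ : ∀ i p → V i (toℕ p) ≡ v i p
  V-toℕ i p = trans (V-fromℕ< (Fin.toℕ<n p)) (cong (v i) (Fin.fromℕ<-toℕ p (Fin.toℕ<n p)))

  toℕ≤L : ∀ {i} (p : Fin (suc (L i))) → toℕ p ≤ L i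
  toℕ≤L p = ℕ.≤-pred (Fin.toℕ<n p)

  V-0 : ∀ i → V i 0 ≡ s
  V-0 i = trans (V-toℕ i fzero) (v-start i)

  V-L : ∀ i → V i (L i) ≡ t
  V-L i = trans (cong (V i) (sym (Fin.toℕ-fromℕ (L i)))) (trans (V-toℕ i (fromℕ (L i))) (v-end i))

  V-injective : ∀ {i a b} → a ≤ L i → b ≤ L i → V i a ≡ V i b → a ≡ b
  V-injective {i} {a} {b} a≤L b≤L e = begin
    a                       ≡⟨ Fin.toℕ-fromℕ< (s≤s a≤L) ⟨
    toℕ (fromℕ< (s≤s a≤L))  ≡⟨ cong toℕ (v-path i va≡vb) ⟩
    toℕ (fromℕ< (s≤s b≤L))  ≡⟨ Fin.toℕ-fromℕ< (s≤s b≤L) ⟩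
    b                       ∎
    where
    open ≡-Reasoning
    va≡vb : v i (fromℕ< (s≤s a≤L)) ≡ v i (fromℕ< (s≤s b≤L))
    va≡vb = trans (sym (V-fromℕ< (s≤s a≤L))) (trans e (V-fromℕ< (s≤s b≤L)))

  V≡s⇒a≡0 : ∀ {i a} → a ≤ L i → V i a ≡ s → a ≡ 0
  V≡s⇒a≡0 {i} a≤L e = V-injective a≤L z≤n (trans e (sym (V-0 i)))

  V≡t⇒a≡L : ∀ {i a} → a ≤ L i → V i a ≡ t → a ≡ L i
  V≡t⇒a≡L {i} a≤L e = V-injective a≤L ℕ.≤-refl (trans e (sym (V-L i)))

  V-shared : ∀ {i j a b} → a ≤ L i → b ≤ L j → V i a ≡ V j b →
    (i ≡ j × a ≡ b) ⊎ (a ≡ 0 × b ≡ 0) ⊎ (a ≡ L i × b ≡ L j)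
  V-shared {i} {j} {a} {b} a≤L b≤L e with i ≟ j
  ... | yes refl = inj₁ (refl , V-injective a≤L b≤L e)
  ... | no  i≢j with v-disj i j _ _ i≢j (trans (sym (V-fromℕ< (s≤s a≤L))) (trans e (V-fromℕ< (s≤s b≤L))))
  ...   | inj₁ at-s = inj₂ (inj₁ (V≡s⇒a≡0 a≤L Va≡s , V≡s⇒a≡0 b≤L (trans (sym e) Va≡s)))
    where
    Va≡s : V i a ≡ s
    Va≡s = trans (V-fromℕ< (s≤s a≤L)) at-s
  ...   | inj₂ at-t = inj₂ (inj₂ (V≡t⇒a≡L a≤L Va≡t , V≡t⇒a≡L b≤L (trans (sym e) Va≡t)))
    where
    Va≡t : V i a ≡ t
    Va≡t = trans (V-fromℕ< (s≤s a≤L)) at-t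

  V-inner-unique : ∀ {i j a b} → Inner i a → b ≤ L j → V j b ≡ V i a → j ≡ i × b ≡ a
  V-inner-unique (0<a , a<L) b≤L e with V-shared b≤L (ℕ.<⇒≤ a<L) e
  ... | inj₁ same             = same
  ... | inj₂ (inj₁ (_ , a≡0)) = ⊥-elim (ℕ.<-irrefl (sym a≡0) 0<a)
  ... | inj₂ (inj₂ (_ , a≡L)) = ⊥-elim (ℕ.<-irrefl a≡L a<L)

  position-cases : ∀ {i a} → a ≤ L i → a ≡ 0 ⊎ a ≡ L i ⊎ Inner i a
  position-cases {a = zero}  _ = inj₁ refl
  position-cases {i} {suc a} a≤L with suc a ℕ.≟ L i
  ... | yes a≡L = inj₂ (inj₁ a≡L)
  ... | no  a≢L = inj₂ (inj₂ (s≤s z≤n , ℕ.≤∧≢⇒< a≤L a≢L))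

  odd⇒inner : ∀ {i a} → a ≤ L i → even a ≡ false → Inner i a
  odd⇒inner {i} a≤L odd with position-cases a≤L
  ... | inj₁ refl        = ⊥-elim (true≢false odd)
  ... | inj₂ (inj₁ refl) = ⊥-elim (true≢false (trans (sym (even-L i)) odd))
  ... | inj₂ (inj₂ ι)    = ι

  inner-pred-L : ∀ i → Inner i (pred (L i))
  inner-pred-L i = odd⇒inner ℕ.pred[n]≤n (trans (even-pred (0<L i)) (cong not (even-L i)))

  data Vertex : Fin n → Set where
    source : Vertex s
    target : Vertex t
    inner  : ∀ {i a} → Inner i a → Vertex (V i a)

  vertexAt : ∀ {i a} → a ≤ L i → Vertex (V i a)
  vertexAt {i} a≤L with position-cases a≤L
  ... | inj₁ refl        = subst Vertex (sym (V-0 i)) source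
  ... | inj₂ (inj₁ refl) = subst Vertex (sym (V-L i)) target
  ... | inj₂ (inj₂ ι)    = inner ι

  vertex : ∀ x → Vertex x
  vertex x with v-cover x
  ... | i , p , vp≡x = subst Vertex (trans (V-toℕ i p) vp≡x) (vertexAt (toℕ≤L p))

  module _ {A : Set} (x₀ xₜ : A) (F : Fin k → ℕ → A) where

    onPosition : Fin k → ℕ → A
    onPosition i a with a ℕ.≟ 0 | a ℕ.≟ L i
    ... | yes _ | _     = x₀
    ... | no  _ | yes _ = xₜ
    ... | no  _ | no  _ = F i a

    onPosition-L : ∀ i → onPosition i (L i) ≡ xₜ
    onPosition-L i with L i ℕ.≟ 0 | L i ℕ.≟ L i
    ... | yes L≡0 | _       = ⊥-elim (ℕ.<-irrefl (sym L≡0) (0<L i))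
    ... | no  _   | yes _   = refl
    ... | no  _   | no  L≢L = ⊥-elim (L≢L refl)

    onPosition-inner : ∀ {i a} → Inner i a → onPosition i a ≡ F i a
    onPosition-inner {i} {a} (0<a , a<L) with a ℕ.≟ 0 | a ℕ.≟ L i
    ... | yes a≡0 | _       = ⊥-elim (ℕ.<-irrefl (sym a≡0) 0<a)
    ... | no  _   | yes a≡L = ⊥-elim (ℕ.<-irrefl a≡L a<L)
    ... | no  _   | no  _   = refl

    opaque
      onCover : ∀ {x} → (Σ (Fin k) λ i → Σ (Fin (suc (L i))) λ p → v i p ≡ x) → A
      onCover (i , p , _) = onPosition i (toℕ p)

      -- Functions on vertices are defined through positions; since a position of s or t is sent
      -- to x₀ or xₜ, the position chosen by v-cover does not matter.
      byPosition : Fin n → A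
      byPosition x = onCover (v-cover x)

      onCover-V : ∀ {i a} (c : Σ (Fin k) λ j → Σ (Fin (suc (L j))) λ p → v j p ≡ V i a) →
        a ≤ L i → onCover c ≡ onPosition i a
      onCover-V {i} (j , p , e) a≤L with V-shared (toℕ≤L p) a≤L (trans (V-toℕ j p) e)
      ... | inj₁ (refl , p≡a)       = cong (onPosition j) p≡a
      ... | inj₂ (inj₁ (p≡0 , refl)) rewrite p≡0 = refl
      ... | inj₂ (inj₂ (p≡L , refl)) rewrite p≡L = trans (onPosition-L j) (sym (onPosition-L i))

      byPosition-V : ∀ {i a} → a ≤ L i → byPosition (V i a) ≡ onPosition i a
      byPosition-V {i} {a} a≤L = onCover-V (v-cover (V i a)) a≤L

    byPosition-s : byPosition s ≡ x₀
    byPosition-s = trans (cong byPosition (sym (V-0 i))) (byPosition-V {i} {0} z≤n)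
      where
      i : Fin k
      i = proj₁ (v-cover s)

    byPosition-t : byPosition t ≡ xₜ
    byPosition-t =
      trans (cong byPosition (sym (V-L i))) (trans (byPosition-V {i} {L i} ℕ.≤-refl) (onPosition-L i))
      where
      i : Fin k
      i = proj₁ (v-cover t)

    byPosition-inner : ∀ {i a} → Inner i a → byPosition (V i a) ≡ F i a
    byPosition-inner {i} {a} ι@(_ , a<L) = trans (byPosition-V {i} {a} (ℕ.<⇒≤ a<L)) (onPosition-inner ι)

  E-sym : ∀ {x y} → E x y → E y x
  E-sym e = proj₂ (edges _ _) (Σ.map₂ (Σ.map₂ Sum.swap) (proj₁ (edges _ _) e))

  edge : ∀ {i a} → a < L i → E (V i a) (V i (suc a))
  edge {i} {a} a<L = proj₂ (edges _ _) (i , p , inj₁ (lower , upper))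
    where
    p : Fin (L i)
    p = fromℕ< a<L
    lower : V i a ≡ v i (inject₁ p)
    lower = trans (cong (V i) (sym (trans (Fin.toℕ-inject₁ p) (Fin.toℕ-fromℕ< a<L)))) (V-toℕ i (inject₁ p))
    upper : V i (suc a) ≡ v i (fsuc p)
    upper = trans (cong (V i ∘ suc) (sym (Fin.toℕ-fromℕ< a<L))) (V-toℕ i (fsuc p))

  edge-pred : ∀ {i a} → 0 < a → a ≤ L i → E (V i a) (V i (pred a))
  edge-pred {a = suc a} _ a<L = E-sym (edge a<L)

  edge-s : ∀ i → E s (V i 1)
  edge-s i = subst (λ x → E x (V i 1)) (V-0 i) (edge (0<L i))

  edge-t : ∀ i → E t (V i (pred (L i)))
  edge-t i = subst (λ x → E x (V i (pred (L i)))) (V-L i) (edge-pred (0<L i) ℕ.≤-refl)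

  edge-position : ∀ {x y} → E x y →
    Σ (Fin k) λ i → Σ ℕ λ a → a < L i × SamePair x y (V i a) (V i (suc a))
  edge-position e with proj₁ (edges _ _) e
  ... | i , p , same =
    i , toℕ p , Fin.toℕ<n p , subst₂ (SamePair _ _) (sym lower) (sym (V-toℕ i (fsuc p))) same
    where
    lower : V i (toℕ p) ≡ v i (inject₁ p)
    lower = trans (cong (V i) (sym (Fin.toℕ-inject₁ p))) (V-toℕ i (inject₁ p))

  vertexSet : (Fin k → ℕ → Bool) → Subset n
  vertexSet F = tabulate (byPosition true true F)

  module _ {F : Fin k → ℕ → Bool} where

    s∈vertexSet : s ∈ vertexSet F
    s∈vertexSet = ∈-tabulate⁺ (byPosition-s true true F)

    t∈vertexSet : t ∈ vertexSet F
    t∈vertexSet = ∈-tabulate⁺ (byPosition-t true true F)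

    ∈vertexSet⁺ : ∀ {i a} → a ≤ L i → (Inner i a → F i a ≡ true) → V i a ∈ vertexSet F
    ∈vertexSet⁺ {i} a≤L inner⇒F with position-cases a≤L
    ... | inj₁ refl        = subst (_∈ vertexSet F) (sym (V-0 i)) s∈vertexSet
    ... | inj₂ (inj₁ refl) = subst (_∈ vertexSet F) (sym (V-L i)) t∈vertexSet
    ... | inj₂ (inj₂ ι)    = ∈-tabulate⁺ (trans (byPosition-inner true true F ι) (inner⇒F ι))

    ∈vertexSet⁻ : ∀ {i a} → Inner i a → V i a ∈ vertexSet F → F i a ≡ true
    ∈vertexSet⁻ ι x∈ = trans (sym (byPosition-inner true true F ι)) (∈-tabulate⁻ x∈)

    vertexSet-cover : (∀ i a → F i (suc a) ≡ not (F i a)) → IsVertexCover E (vertexSet F)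
    vertexSet-cover alternating x y e with edge-position e
    ... | i , a , a<L , same = endpoint same (lower-or-upper (F i a) refl)
      where
      lower-or-upper : ∀ b → F i a ≡ b → V i a ∈ vertexSet F ⊎ V i (suc a) ∈ vertexSet F
      lower-or-upper true  Fa = inj₁ (∈vertexSet⁺ (ℕ.<⇒≤ a<L) (λ _ → Fa))
      lower-or-upper false Fa = inj₂ (∈vertexSet⁺ a<L (λ _ → trans (alternating i a) (cong not Fa)))
      endpoint : ∀ {x y a b} → SamePair x y a b → a ∈ vertexSet F ⊎ b ∈ vertexSet F →
                 x ∈ vertexSet F ⊎ y ∈ vertexSet F
      endpoint (inj₁ (refl , refl)) = id
      endpoint (inj₂ (refl , refl)) = Sum.swap

  U₀ : Subset n
  U₀ = vertexSet (λ _ a → even a)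

  U : Fin k → Subset n
  U j = vertexSet (λ i a → does (i ≟ j) xor even a)

  U₀-cover : IsVertexCover E U₀
  U₀-cover = vertexSet-cover (λ _ _ → refl)

  U-cover : ∀ j → IsVertexCover E (U j)
  U-cover j = vertexSet-cover (λ i a → sym (not-distribʳ-xor (does (i ≟ j)) (even a)))

  ∈U₀ : ∀ {i a} → a ≤ L i → even a ≡ true → V i a ∈ U₀
  ∈U₀ a≤L even-a = ∈vertexSet⁺ a≤L (λ _ → even-a)

  odd∉U₀ : ∀ {i a} → Inner i a → even a ≡ false → V i a ∉ U₀
  odd∉U₀ ι odd x∈ = true≢false (trans (sym (∈vertexSet⁻ ι x∈)) odd)

  ∈U-odd : ∀ {j a} → a ≤ L j → even a ≡ false → V j a ∈ U j
  ∈U-odd {j} a≤L odd = ∈vertexSet⁺ a≤L (λ _ → cong₂ _xor_ (dec-true (j ≟ j) refl) odd)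

  ∈U-even : ∀ {i j a} → i ≢ j → a ≤ L i → even a ≡ true → V i a ∈ U j
  ∈U-even {i} {j} i≢j a≤L even-a = ∈vertexSet⁺ a≤L (λ _ → cong₂ _xor_ (dec-false (i ≟ j) i≢j) even-a)

  ∈U⇒odd : ∀ {j a} → Inner j a → V j a ∈ U j → even a ≡ false
  ∈U⇒odd {j} {a} ι x∈ =
    not-injective (trans (sym (cong (_xor even a) (dec-true (j ≟ j) refl))) (∈vertexSet⁻ ι x∈))

  ∈U⇒even : ∀ {i j a} → i ≢ j → Inner i a → V i a ∈ U j → even a ≡ true
  ∈U⇒even {i} {j} {a} i≢j ι x∈ = trans (sym (cong (_xor even a) (dec-false (i ≟ j) i≢j))) (∈vertexSet⁻ ι x∈)

  ExternalAt : Fin k → ℕ → Set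
  ExternalAt i a = (∃ λ q → a ≡ 2 * q + 1) ⊎ (a ≡ 0) ⊎ (a ≡ L i)

  InternalAt : ℕ → Set
  InternalAt a = ∃ λ q → a ≡ 2 * q

  ∈U⇔externalAt : ∀ {i a} → a ≤ L i → (V i a ∈ U i) ⇔ ExternalAt i a
  ∈U⇔externalAt {i} {a} a≤L = to , from
    where
    to : V i a ∈ U i → ExternalAt i a
    to x∈ with position-cases a≤L
    ... | inj₁ a≡0        = inj₂ (inj₁ a≡0)
    ... | inj₂ (inj₁ a≡L) = inj₂ (inj₂ a≡L)
    ... | inj₂ (inj₂ ι)   = inj₁ (odd⇒2*+1 (∈U⇒odd ι x∈))
    from : ExternalAt i a → V i a ∈ U i
    from (inj₁ (q , a≡2q+1)) = ∈U-odd a≤L (subst (λ b → even b ≡ false) (sym a≡2q+1) (even-2*+1 q))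
    from (inj₂ (inj₁ refl))   = subst (_∈ U i) (sym (V-0 i)) s∈vertexSet
    from (inj₂ (inj₂ refl))   = subst (_∈ U i) (sym (V-L i)) t∈vertexSet

  ∈U⇔internalAt : ∀ {i j a} → i ≢ j → a ≤ L i → (V i a ∈ U j) ⇔ InternalAt a
  ∈U⇔internalAt {i} {j} {a} i≢j a≤L = to , from
    where
    to : V i a ∈ U j → InternalAt a
    to x∈ with position-cases a≤L
    ... | inj₁ a≡0        = 0 , a≡0
    ... | inj₂ (inj₁ a≡L) = m i , a≡L
    ... | inj₂ (inj₂ ι)   = even⇒2* (∈U⇒even i≢j ι x∈)
    from : InternalAt a → V i a ∈ U j
    from (q , a≡2q) = ∈U-even i≢j a≤L (subst (λ b → even b ≡ true) (sym a≡2q) (even-2* q))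

  U-isU : ∀ j → IsU M j (U j)
  U-isU j = (λ p → at-vertex (∈U⇔externalAt (toℕ≤L p)))
          , (λ i i≢j p → at-vertex (∈U⇔internalAt i≢j (toℕ≤L p)))
    where
    at-vertex : ∀ {P : Set} {i p} → (V i (toℕ p) ∈ U j) ⇔ P → (v i p ∈ U j) ⇔ P
    at-vertex {i = i} {p} (to , from) =
      to ∘ subst (_∈ U j) (sym (V-toℕ i p)) , subst (_∈ U j) (V-toℕ i p) ∘ from

  IsU-unique : ∀ {j W W′} → IsU M j W → IsU M j W′ → W ≡ W′
  IsU-unique isU isU′ = ⊆-antisym (transfer isU isU′) (transfer isU′ isU)
    where
    transfer : ∀ {j W W′} → IsU M j W → IsU M j W′ → ∀ {x} → x ∈ W → x ∈ W′
    transfer {j} (ext , int) (ext′ , int′) {x} x∈ with v-cover x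
    ... | i , p , refl with i ≟ j
    ...   | yes refl = proj₂ (ext′ p) (proj₁ (ext p) x∈)
    ...   | no  i≢j  = proj₂ (int′ i i≢j p) (proj₁ (int i i≢j p) x∈)

module Rotations {n k : ℕ} {E : Rel n} (M : EvenMelon n k E) where
  open EvenMelon M
  open Positions M public

  shift : Fin k → Fin k → Fin k → ℕ → ℕ
  shift i j i′ a with i′ ≟ i | i′ ≟ j
  ... | yes _ | _     = pred a
  ... | no  _ | yes _ = suc a
  ... | no  _ | no  _ = a

  -- Moves the odd vertices of path i one step towards s, and the even vertices of path j,
  -- s included, one step towards t.
  rotate : Fin k → Fin k → Fin n → Fin n
  rotate i j = byPosition (V j 1) t (λ i′ a → V i′ (shift i j i′ a))

  module _ {i j : Fin k} where

    rotate-s : rotate i j s ≡ V j 1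
    rotate-s = byPosition-s _ _ _

    rotate-t : rotate i j t ≡ t
    rotate-t = byPosition-t _ _ _

    rotate-down : ∀ {a} → Inner i a → rotate i j (V i a) ≡ V i (pred a)
    rotate-down {a} ι = trans (byPosition-inner _ _ _ ι) (cong (V i) shift-i)
      where
      shift-i : shift i j i a ≡ pred a
      shift-i with i ≟ i
      ... | yes _   = refl
      ... | no  i≢i = ⊥-elim (i≢i refl)

    rotate-up : ∀ {a} → j ≢ i → a < L j → rotate i j (V j a) ≡ V j (suc a)
    rotate-up {zero}  _   _   = trans (cong (rotate i j) (V-0 j)) rotate-s
    rotate-up {suc a} j≢i a<L = trans (byPosition-inner _ _ _ (s≤s z≤n , a<L)) (cong (V j) shift-j)
      where
      shift-j : shift i j j (suc a) ≡ suc (suc a)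
      shift-j with j ≟ i | j ≟ j
      ... | yes j≡i | _       = ⊥-elim (j≢i j≡i)
      ... | no  _   | yes _   = refl
      ... | no  _   | no  j≢j = ⊥-elim (j≢j refl)

    rotate-fixed : ∀ {i′ a} → i′ ≢ i → i′ ≢ j → Inner i′ a → rotate i j (V i′ a) ≡ V i′ a
    rotate-fixed {i′} {a} i′≢i i′≢j ι = trans (byPosition-inner _ _ _ ι) (cong (V i′) shift-i′)
      where
      shift-i′ : shift i j i′ a ≡ a
      shift-i′ with i′ ≟ i | i′ ≟ j
      ... | yes i′≡i | _        = ⊥-elim (i′≢i i′≡i)
      ... | no  _    | yes i′≡j = ⊥-elim (i′≢j i′≡j)
      ... | no  _    | no  _    = refl

  rotate-spec : ∀ {i j x} → i ≢ j → x ∈ U i →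
    rotate i j x ∈ U j × _∈N[_] E (rotate i j x) x × rotate j i (rotate i j x) ≡ x
  rotate-spec {i} {j} {x} i≢j x∈ with vertex x
  ... | source rewrite rotate-s {i} {j} =
    ∈U-odd (ℕ.<⇒≤ (proj₂ (inner-1 j))) refl , inj₂ (edge-s j) , trans (rotate-down (inner-1 j)) (V-0 j)
  ... | target rewrite rotate-t {i} {j} | rotate-t {j} {i} = t∈vertexSet , inj₁ refl , refl
  ... | inner {i′} {a} ι@(0<a , a<L) with i′ ≟ i
  ...   | yes refl rewrite rotate-down {j = j} ι =
    ∈U-even i≢j (ℕ.<⇒≤ a-1<L) (trans (even-pred 0<a) (cong not (∈U⇒odd ι x∈))) ,
    inj₂ (edge-pred 0<a (ℕ.<⇒≤ a<L)) ,
    trans (rotate-up i≢j a-1<L) (cong (V i) (ℕ.suc-pred a ⦃ >-nonZero 0<a ⦄))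
    where
    a-1<L : pred a < L i
    a-1<L = ℕ.≤-<-trans ℕ.pred[n]≤n a<L
  ...   | no i′≢i with i′ ≟ j
  ...     | yes refl rewrite rotate-up i′≢i a<L =
    ∈U-odd a<L odd-a+1 , inj₂ (edge a<L) , rotate-down (odd⇒inner a<L odd-a+1)
    where
    odd-a+1 : even (suc a) ≡ false
    odd-a+1 = cong not (∈U⇒even i′≢i ι x∈)
  ...     | no i′≢j rewrite rotate-fixed i′≢i i′≢j ι =
    ∈U-even i′≢j (ℕ.<⇒≤ a<L) (∈U⇒even i′≢i ι x∈) , inj₁ refl , rotate-fixed i′≢j i′≢i ι

  Defended : Subset n → Fin n → Fin n → Set
  Defended W x y = Σ (Fin n → Fin n) λ φ → IsDefense E W x y φ × ∃ λ j → IsImage E W φ (U j)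

  Defended-sym : ∀ {W x y} → Defended W x y → Defended W y x
  Defended-sym (φ , (neighbour , injective , attacked) , image) =
    φ , (neighbour , injective , Sum.swap attacked) , image

  rotate-defends : ∀ {i j x y} → i ≢ j → x ∈ U i → rotate i j x ≡ y → Defended (U i) x y
  rotate-defends {i} {j} i≢j x∈ x↦y = rotate i j , (neighbour , injective , inj₁ (x∈ , x↦y)) , j , image
    where
    back : ∀ {u} → u ∈ U i → rotate j i (rotate i j u) ≡ u
    back u∈ = proj₂ (proj₂ (rotate-spec i≢j u∈))
    neighbour : ∀ u → u ∈ U i → _∈N[_] E (rotate i j u) u
    neighbour u u∈ = proj₁ (proj₂ (rotate-spec i≢j u∈))
    injective : ∀ u u′ → u ∈ U i → u′ ∈ U i → rotate i j u ≡ rotate i j u′ → u ≡ u′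
    injective u u′ u∈ u′∈ e = trans (sym (back u∈)) (trans (cong (rotate j i) e) (back u′∈))
    image : IsImage E (U i) (rotate i j) (U j)
    image w = (λ w∈ → let (v∈ , _ , v↦w) = rotate-spec (i≢j ∘ sym) w∈ in rotate j i w , v∈ , v↦w)
            , λ { (u , u∈ , refl) → proj₁ (rotate-spec i≢j u∈) }

  defend-even : ∀ {i j i′ p} → i ≢ j → p < L i′ → even p ≡ true → Defended (U i) (V i′ p) (V i′ (suc p))
  defend-even {i} {j} {i′} {p} i≢j p<L even-p with i′ ≟ i
  ... | yes refl =
    Defended-sym (rotate-defends i≢j (∈U-odd p<L odd-p+1) (rotate-down (odd⇒inner p<L odd-p+1)))
    where
    odd-p+1 : even (suc p) ≡ false
    odd-p+1 = cong not even-p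
  ... | no  i′≢i = rotate-defends (i′≢i ∘ sym) (∈U-even i′≢i (ℕ.<⇒≤ p<L) even-p) (rotate-up i′≢i p<L)

  -- Apart from V i 1, the vertices of U i outside U₀ are the odd inner ones of path i; rotate
  -- matches them with the even inner vertices of path i, which lie outside U i.
  ∣U∣≤1+∣U₀∣ : ∀ {i j} → i ≢ j → ∣ U i ∣ ≤ suc ∣ U₀ ∣
  ∣U∣≤1+∣U₀∣ {i} {j} i≢j = begin
    ∣ U i ∣                 ≤⟨ partners⇒∣p∣≤∣cover∣ E (U i) (rotate i j) (rotate j i) cover rotate-outside ⟩
    ∣ U₀ ∪ ⁅ V i 1 ⁆ ∣      ≤⟨ ∣p∪q∣≤∣p∣+∣q∣ U₀ ⁅ V i 1 ⁆ ⟩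
    ∣ U₀ ∣ + ∣ ⁅ V i 1 ⁆ ∣  ≡⟨ cong (∣ U₀ ∣ +_) (∣⁅x⁆∣≡1 (V i 1)) ⟩
    ∣ U₀ ∣ + 1              ≡⟨ ℕ.+-comm ∣ U₀ ∣ 1 ⟩
    suc ∣ U₀ ∣              ∎
    where
    open ℕ.≤-Reasoning
    cover : IsVertexCover E (U₀ ∪ ⁅ V i 1 ⁆)
    cover x y e = Sum.map (x∈p∪q⁺ ∘ inj₁) (x∈p∪q⁺ ∘ inj₁) (U₀-cover x y e)
    rotate-outside : ∀ {z} → z ∈ U i → z ∉ U₀ ∪ ⁅ V i 1 ⁆ →
      E z (rotate i j z) × rotate i j z ∉ U i × rotate j i (rotate i j z) ≡ z
    rotate-outside {z} z∈ z∉ with vertex z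
    ... | source = ⊥-elim (z∉ (x∈p∪q⁺ (inj₁ s∈vertexSet)))
    ... | target = ⊥-elim (z∉ (x∈p∪q⁺ (inj₁ t∈vertexSet)))
    ... | inner {i′} {a} ι@(0<a , a<L) with i′ ≟ i
    ...   | no i′≢i = ⊥-elim (z∉ (x∈p∪q⁺ (inj₁ (∈U₀ (ℕ.<⇒≤ a<L) (∈U⇒even i′≢i ι z∈)))))
    ...   | yes refl with a ℕ.≟ 1
    ...     | yes refl = ⊥-elim (z∉ (x∈p∪q⁺ (inj₂ (x∈⁅x⁆ (V i 1)))))
    ...     | no  a≢1 rewrite rotate-down {j = j} ι =
      edge-pred 0<a (ℕ.<⇒≤ a<L) ,
      (λ a-1∈ → true≢false (trans (sym even-a-1) (∈U⇒odd ι′ a-1∈))) ,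
      trans (rotate-up i≢j (proj₂ ι′)) (cong (V i) (ℕ.suc-pred a ⦃ >-nonZero 0<a ⦄))
      where
      ι′ : Inner i (pred a)
      ι′ = ℕ.pred-mono-≤ (ℕ.≤∧≢⇒< 0<a (a≢1 ∘ sym)) , ℕ.≤-<-trans ℕ.pred[n]≤n a<L
      even-a-1 : even (pred a) ≡ true
      even-a-1 = trans (even-pred 0<a) (cong not (∈U⇒odd ι z∈))

-- A matching of size ∣ U₀ ∣ avoiding the odd inner vertex V j r: s is matched along path A, t along
-- path C, and every even inner vertex to its neighbour below it on C and below r on j, to its
-- neighbour above it everywhere else.
module Matching {n k : ℕ} {E : Rel n} (M : EvenMelon n k E)
                {A C j : Fin k} (A≢C : A ≢ C) (A≢j : A ≢ j) (C≢j : C ≢ j) where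
  open EvenMelon M
  open Positions M

  module _ {r : ℕ} (r≤L : r ≤ L j) (odd-r : even r ≡ false) where

    θ : Fin k → ℕ
    θ i with i ≟ C | i ≟ j
    ... | yes _ | _     = L C
    ... | no  _ | yes _ = r
    ... | no  _ | no  _ = 0

    θ-A : θ A ≡ 0
    θ-A with A ≟ C | A ≟ j
    ... | yes A≡C | _       = ⊥-elim (A≢C A≡C)
    ... | no  _   | yes A≡j = ⊥-elim (A≢j A≡j)
    ... | no  _   | no  _   = refl

    θ-C : θ C ≡ L C
    θ-C with C ≟ C
    ... | yes _   = refl
    ... | no  C≢C = ⊥-elim (C≢C refl)

    θ-j : θ j ≡ r
    θ-j with j ≟ C | j ≟ j
    ... | yes j≡C | _       = ⊥-elim (C≢j (sym j≡C))
    ... | no  _   | yes _   = refl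
    ... | no  _   | no  j≢j = ⊥-elim (j≢j refl)

    partnerAt : Fin k → ℕ → Fin n
    partnerAt i a with a <? θ i
    ... | yes _ = V i (pred a)
    ... | no  _ = V i (suc a)

    unpartnerAt : Fin k → ℕ → Fin n
    unpartnerAt i b with b <? θ i
    ... | yes _ = V i (suc b)
    ... | no  _ = V i (pred b)

    partner unpartner : Fin n → Fin n
    partner   = byPosition (V A 1) (V C (pred (L C))) partnerAt
    unpartner = byPosition s t unpartnerAt

    partner-down : ∀ {i a} → Inner i a → a < θ i → partner (V i a) ≡ V i (pred a)
    partner-down {i} {a} ι a<θ with a <? θ i | byPosition-inner (V A 1) (V C (pred (L C))) partnerAt ι
    ... | yes _   | e = e
    ... | no  a≮θ | _ = ⊥-elim (a≮θ a<θ)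

    partner-up : ∀ {i a} → Inner i a → ¬ a < θ i → partner (V i a) ≡ V i (suc a)
    partner-up {i} {a} ι a≮θ with a <? θ i | byPosition-inner (V A 1) (V C (pred (L C))) partnerAt ι
    ... | yes a<θ | _ = ⊥-elim (a≮θ a<θ)
    ... | no  _   | e = e

    unpartner-up : ∀ {i b} → Inner i b → b < θ i → unpartner (V i b) ≡ V i (suc b)
    unpartner-up {i} {b} ι b<θ with b <? θ i | byPosition-inner s t unpartnerAt ι
    ... | yes _   | e = e
    ... | no  b≮θ | _ = ⊥-elim (b≮θ b<θ)

    unpartner-down : ∀ {i b} → Inner i b → ¬ b < θ i → unpartner (V i b) ≡ V i (pred b)
    unpartner-down {i} {b} ι b≮θ with b <? θ i | byPosition-inner s t unpartnerAt ι
    ... | yes b<θ | _ = ⊥-elim (b≮θ b<θ)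
    ... | no  _   | e = e

    ≢V-j-r : ∀ {i b} → Inner i b → (i ≡ j → b ≢ r) → V i b ≢ V j r
    ≢V-j-r ι b≢r e with V-inner-unique ι r≤L (sym e)
    ... | refl , r≡b = b≢r refl (sym r≡b)

    partner-spec : ∀ {z} → z ∈ U₀ →
      E z (partner z) × partner z ∉ U₀ × partner z ≢ V j r × unpartner (partner z) ≡ z
    partner-spec {z} z∈ with vertex z
    ... | source rewrite byPosition-s (V A 1) (V C (pred (L C))) partnerAt =
      edge-s A ,
      odd∉U₀ (inner-1 A) refl ,
      ≢V-j-r (inner-1 A) (λ A≡j _ → A≢j A≡j) ,
      trans (unpartner-down (inner-1 A) (λ 1<θ → ℕ.<-irrefl (sym θ-A) (ℕ.<-trans (s≤s z≤n) 1<θ))) (V-0 A)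
    ... | target rewrite byPosition-t (V A 1) (V C (pred (L C))) partnerAt =
      edge-t C ,
      odd∉U₀ (inner-pred-L C) (trans (even-pred (0<L C)) (cong not (even-L C))) ,
      ≢V-j-r (inner-pred-L C) (λ C≡j _ → C≢j C≡j) ,
      trans (unpartner-up (inner-pred-L C) (subst (pred (L C) <_) (sym θ-C) (proj₂ (inner-pred-L C))))
            (trans (cong (V C) (ℕ.suc-pred (L C) ⦃ >-nonZero (0<L C) ⦄)) (V-L C))
    ... | inner {i} {a} ι@(0<a , a<L) with a <? θ i
    ...   | yes a<θ rewrite partner-down ι a<θ =
      edge-pred 0<a (ℕ.<⇒≤ a<L) ,
      odd∉U₀ ι′ odd-a-1 ,
      ≢V-j-r ι′ (λ { refl a-1≡r → ℕ.<⇒≱ (subst (a <_) (trans θ-j (sym a-1≡r)) a<θ) ℕ.pred[n]≤n }) ,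
      trans (unpartner-up ι′ (ℕ.≤-<-trans ℕ.pred[n]≤n a<θ)) (cong (V i) (ℕ.suc-pred a ⦃ >-nonZero 0<a ⦄))
      where
      odd-a-1 : even (pred a) ≡ false
      odd-a-1 = trans (even-pred 0<a) (cong not (∈vertexSet⁻ ι z∈))
      ι′ : Inner i (pred a)
      ι′ = odd⇒inner (ℕ.≤-trans ℕ.pred[n]≤n (ℕ.<⇒≤ a<L)) odd-a-1
    ...   | no a≮θ rewrite partner-up ι a≮θ =
      edge a<L ,
      odd∉U₀ ι′ odd-a+1 ,
      ≢V-j-r ι′ (λ { refl a+1≡r → a≮θ (subst (a <_) (sym (trans θ-j (sym a+1≡r))) ℕ.≤-refl) }) ,
      unpartner-down ι′ (λ a+1<θ → a≮θ (ℕ.<-trans (ℕ.n<1+n a) a+1<θ))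
      where
      odd-a+1 : even (suc a) ≡ false
      odd-a+1 = cong not (∈vertexSet⁻ ι z∈)
      ι′ : Inner i (suc a)
      ι′ = odd⇒inner a<L odd-a+1

    ∣U₀∣≤∣cover∣ : ∀ {W} → IsVertexCover E W → ∣ U₀ ∣ ≤ ∣ W ∣
    ∣U₀∣≤∣cover∣ cover = partners⇒∣p∣≤∣cover∣ E U₀ partner unpartner cover λ z∈ _ →
      let (e , ∉U₀ , _ , back) = partner-spec z∈ in e , ∉U₀ , back

    ∣U₀∣<∣cover∣ : ∀ {W} → IsVertexCover E W → V j r ∈ W → ∣ U₀ ∣ < ∣ W ∣
    ∣U₀∣<∣cover∣ {W} cover Vjr∈W =
      ℕ.<-≤-trans (p⊂q⇒∣p∣<∣q∣ U₀⊂Z) (partners⇒∣p∣≤∣cover∣ E Z partner unpartner cover partner-outside)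
      where
      Z : Subset n
      Z = U₀ ∪ ⁅ V j r ⁆
      U₀⊂Z : U₀ ⊂ Z
      U₀⊂Z = p⊆p∪q ⁅ V j r ⁆ , V j r , x∈p∪q⁺ (inj₂ (x∈⁅x⁆ (V j r))) , odd∉U₀ (odd⇒inner r≤L odd-r) odd-r
      partner-outside : ∀ {z} → z ∈ Z → z ∉ W → E z (partner z) × partner z ∉ Z × unpartner (partner z) ≡ z
      partner-outside z∈Z z∉W with x∈p∪q⁻ U₀ ⁅ V j r ⁆ z∈Z
      ... | inj₂ z∈⁅Vjr⁆ = ⊥-elim (z∉W (subst (_∈ W) (sym (x∈⁅y⁆⇒x≡y (V j r) z∈⁅Vjr⁆)) Vjr∈W))
      ... | inj₁ z∈U₀   = let (e , ∉U₀ , ≢Vjr , back) = partner-spec z∈U₀ in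
        e , [ ∉U₀ , ≢Vjr ∘ x∈⁅y⁆⇒x≡y (V j r) ] ∘ x∈p∪q⁻ U₀ ⁅ V j r ⁆ , back

module Symmetric {n k : ℕ} {E : Rel n} (M : EvenMelon n k E) where
  open EvenMelon M
  open Rotations M
  private module R = Rotations (reverse M)

  V-reverse : ∀ {i a} → a ≤ L i → R.V i a ≡ V i (L i ∸ a)
  V-reverse {i} {a} a≤L = begin
    R.V i a                                  ≡⟨ R.V-fromℕ< (s≤s a≤L) ⟩
    v i (opposite (fromℕ< (s≤s a≤L)))        ≡⟨ V-toℕ i (opposite (fromℕ< (s≤s a≤L))) ⟨
    V i (toℕ (opposite (fromℕ< (s≤s a≤L))))  ≡⟨ cong (V i) (Fin.opposite-prop (fromℕ< (s≤s a≤L))) ⟩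
    V i (L i ∸ toℕ (fromℕ< (s≤s a≤L)))       ≡⟨ cong (V i ∘ (L i ∸_)) (Fin.toℕ-fromℕ< (s≤s a≤L)) ⟩
    V i (L i ∸ a)                            ∎
    where open ≡-Reasoning

  V-reverse-inner : ∀ {i a} → Inner i a → Inner i (L i ∸ a) × R.V i (L i ∸ a) ≡ V i a
  V-reverse-inner {i} {a} (0<a , a<L) =
    (ℕ.m<n⇒0<n∸m a<L , ℕ.∸-monoʳ-< 0<a (ℕ.<⇒≤ a<L)) ,
    trans (V-reverse (ℕ.m∸n≤m (L i) a)) (cong (V i) (ℕ.m∸[m∸n]≡n (ℕ.<⇒≤ a<L)))

  vertexSet-reverse : ∀ {F} → (∀ {i a} → Inner i a → F i (L i ∸ a) ≡ F i a) → R.vertexSet F ≡ vertexSet F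
  vertexSet-reverse {F} F-symmetric = ⊆-antisym (λ {x} → proj₁ (same x)) (λ {x} → proj₂ (same x))
    where
    same : ∀ x → (x ∈ R.vertexSet F) ⇔ (x ∈ vertexSet F)
    same x with vertex x
    ... | source = (λ _ → s∈vertexSet) , (λ _ → R.t∈vertexSet)
    ... | target = (λ _ → t∈vertexSet) , (λ _ → R.s∈vertexSet)
    ... | inner {i} {a} ι@(_ , a<L) with V-reverse-inner ι
    ...   | ι′ , e =
      (λ x∈ → ∈vertexSet⁺ (ℕ.<⇒≤ a<L)
                (λ _ → trans (sym (F-symmetric ι))
                             (R.∈vertexSet⁻ ι′ (subst (_∈ R.vertexSet F) (sym e) x∈)))) ,
      (λ x∈ → subst (_∈ R.vertexSet F) e
                (R.∈vertexSet⁺ (ℕ.<⇒≤ (proj₂ ι′)) (λ _ → trans (F-symmetric ι) (∈vertexSet⁻ ι x∈))))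

  U-reverse : ∀ j → R.U j ≡ U j
  U-reverse j = vertexSet-reverse λ {i} {a} (_ , a<L) →
    cong (does (i ≟ j) xor_) (even-∸ (ℕ.<⇒≤ a<L) (even-L i))

  -- In the reversed melon the edge between V i′ p and V i′ (suc p) sits at the even position q.
  defend-odd : ∀ {i j i′ p} → i ≢ j → p < L i′ → even p ≡ false → Defended (U i) (V i′ p) (V i′ (suc p))
  defend-odd {i} {j} {i′} {p} i≢j p<L odd-p =
    subst (λ W → Defended W (V i′ p) (V i′ (suc p))) (U-reverse i)
      (Defended-sym (subst₂ (Defended (R.U i)) lower upper (from-reverse (R.defend-even i≢j q<L even-q))))
    where
    q : ℕ
    q = L i′ ∸ suc p
    q<L : q < L i′
    q<L = ℕ.∸-monoʳ-< (s≤s z≤n) p<L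
    even-q : even q ≡ true
    even-q = trans (even-∸ p<L (even-L i′)) (cong not odd-p)
    lower : R.V i′ q ≡ V i′ (suc p)
    lower = trans (V-reverse (ℕ.<⇒≤ q<L)) (cong (V i′) (ℕ.m∸[m∸n]≡n p<L))
    upper : R.V i′ (suc q) ≡ V i′ p
    upper = trans (V-reverse q<L)
                  (cong (V i′) (trans (cong (L i′ ∸_) (sym (ℕ.+-∸-assoc 1 p<L))) (ℕ.m∸[m∸n]≡n (ℕ.<⇒≤ p<L))))
    from-reverse : ∀ {W x y} → R.Defended W x y → Defended W x y
    from-reverse (φ , defence , j , image) = φ , defence , j , subst (IsImage E _ φ) (U-reverse j) image

  defend-edge : ∀ {i j i′ p} → i ≢ j → p < L i′ → Defended (U i) (V i′ p) (V i′ (suc p))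
  defend-edge {p = p} i≢j p<L with even p in even-p
  ... | true  = defend-even i≢j p<L even-p
  ... | false = defend-odd i≢j p<L even-p

  defend : ∀ {i j x y} → i ≢ j → E x y → Defended (U i) x y
  defend i≢j e with edge-position e
  ... | _ , _ , p<L , inj₁ (refl , refl) = defend-edge i≢j p<L
  ... | _ , _ , p<L , inj₂ (refl , refl) = Defended-sym (defend-edge i≢j p<L)

two-others : ∀ {k} (j : Fin (3 + k)) → Σ (Fin (3 + k)) λ A → Σ (Fin (3 + k)) λ C → A ≢ C × A ≢ j × C ≢ j
two-others fzero           = fsuc fzero , fsuc (fsuc fzero) , (λ ()) , (λ ()) , (λ ())
two-others (fsuc fzero)    = fzero , fsuc (fsuc fzero) , (λ ()) , (λ ()) , (λ ())
two-others (fsuc (fsuc _)) = fzero , fsuc fzero , (λ ()) , (λ ()) , (λ ())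

module ThreePaths {n k : ℕ} {E : Rel n} (M : EvenMelon n (3 + k) E) where
  open EvenMelon M
  open Rotations M
  open Symmetric M

  another : (i : Fin (3 + k)) → Σ (Fin (3 + k)) λ j → i ≢ j
  another i = let (A , _ , _ , A≢i , _) = two-others i in A , A≢i ∘ sym

  U₀-minimum : ∀ {W} → IsVertexCover E W → ∣ U₀ ∣ ≤ ∣ W ∣
  U₀-minimum = let (A , C , A≢C , A≢j , C≢j) = two-others fzero in
    Matching.∣U₀∣≤∣cover∣ M A≢C A≢j C≢j (ℕ.<⇒≤ (proj₂ (inner-1 fzero))) refl

  odd∈cover⇒∣U₀∣<∣cover∣ : ∀ {W j r} → IsVertexCover E W → r ≤ L j → even r ≡ false → V j r ∈ W →
    ∣ U₀ ∣ < ∣ W ∣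
  odd∈cover⇒∣U₀∣<∣cover∣ {j = j} = let (A , C , A≢C , A≢j , C≢j) = two-others j in
    λ cover r≤L odd-r → Matching.∣U₀∣<∣cover∣ M A≢C A≢j C≢j r≤L odd-r cover

  ∣U∣≡1+∣U₀∣ : ∀ i → ∣ U i ∣ ≡ suc ∣ U₀ ∣
  ∣U∣≡1+∣U₀∣ i = ℕ.≤-antisym (∣U∣≤1+∣U₀∣ (proj₂ (another i)))
    (odd∈cover⇒∣U₀∣<∣cover∣ (U-cover i) 1≤L refl (∈U-odd 1≤L refl))
    where
    1≤L : 1 ≤ L i
    1≤L = ℕ.<⇒≤ (proj₂ (inner-1 i))

  family-isEVCClass : IsEVCClass E (melonFamily M) (suc ∣ U₀ ∣)
  family-isEVCClass = (U fzero , fzero , U-isU fzero) , members , defences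
    where
    members : ∀ W → melonFamily M W → IsVertexCover E W × ∣ W ∣ ≡ suc ∣ U₀ ∣
    members W (i , isU) with IsU-unique isU (U-isU i)
    ... | refl = U-cover i , ∣U∣≡1+∣U₀∣ i
    defences : ∀ W → melonFamily M W → ∀ x y → E x y →
      Σ (Fin n → Fin n) λ φ → IsDefense E W x y φ × Σ (Subset n) λ W′ → melonFamily M W′ × IsImage E W φ W′
    defences W (i , isU) x y e with IsU-unique isU (U-isU i)
    ... | refl = let (φ , defence , j , image) = defend (proj₂ (another i)) e in
                 φ , defence , U j , (j , U-isU j) , image

  odd∈member⇒∣U₀∣<size : ∀ {𝒰 c W} → IsEVCClass E 𝒰 c → 𝒰 W → V fzero 1 ∈ W → ∣ U₀ ∣ < c
  odd∈member⇒∣U₀∣<size (_ , members , _) W∈ V₀₁∈W =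
    ℕ.<-≤-trans (odd∈cover⇒∣U₀∣<∣cover∣ (proj₁ (members _ W∈)) (ℕ.<⇒≤ (proj₂ (inner-1 fzero))) refl V₀₁∈W)
                (ℕ.≤-reflexive (proj₂ (members _ W∈)))

  -- Attacking the edge from s to V fzero 1 puts the odd vertex V fzero 1 into some cover of the class.
  evcClass⇒∣U₀∣<size : ∀ {𝒰 c} → IsEVCClass E 𝒰 c → ∣ U₀ ∣ < c
  evcClass⇒∣U₀∣<size class@((W , W∈) , _ , defences) with defences W W∈ s (V fzero 1) (edge-s fzero)
  ... | _ , (_ , _ , inj₁ (s∈W , s↦V₀₁)) , _ , W′∈ , image =
    odd∈member⇒∣U₀∣<size class W′∈ (proj₂ (image (V fzero 1)) (s , s∈W , s↦V₀₁))
  ... | _ , (_ , _ , inj₂ (V₀₁∈W , _)) , _ = odd∈member⇒∣U₀∣<size class W∈ V₀₁∈W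

theorem11 : (n k : ℕ) (E : Rel n) (M : EvenMelon n k E) → 3 ≤ k →
    Σ ℕ (λ c → IsVCNumber E c × IsEVCNumber E (suc c)
                × IsEVCClass E (melonFamily M) (suc c))
theorem11 n (suc (suc (suc k))) E M (s≤s (s≤s (s≤s _))) =
  ∣ U₀ ∣ ,
  ((U₀ , U₀-cover , refl) , λ _ → U₀-minimum) ,
  ((melonFamily M , family-isEVCClass) , λ _ _ → evcClass⇒∣U₀∣<size) ,
  family-isEVCClass
  where
  open Positions M using (U₀; U₀-cover)
  open ThreePaths M
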